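{- Let $M\rightarrow M'$ be a matroid perspective on a finite linearly ordered set $E$. Define $\phi^*_{M,M'},\phi_{M,M'}:2^E\to 2^E$ by $\phi^*_{M,M'}(A)=(A\cup P_{M'}(A))\setminus\mathrm{Int}_{M'}(A)$ and $\phi_{M,M'}(A)=(A\setminus Q_M(A))\cup\mathrm{Ext}_M(A)$. Then both are involutions of $2^E$; $\phi^*_{M,M'}$ exchanges corank in $M'$ and internal activity in $M'$, i.e. $cr_{M'}(\phi^*_{M,M'}(A))=\iota_{M'}(A)$ and $\iota_{M'}(\phi^*_{M,M'}(A))=cr_{M'}(A)$, and $\phi_{M,M'}$ exchanges nullity in $M$ and external activity in $M$, i.e. $nl_M(\phi_{M,M'}(A))=\epsilon_M(A)$ and $\epsilon_M(\phi_{M,M'}(A))=nl_M(A)$, for all $A\subseteq E$.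
   Context: A matroid perspective $M\rightarrow M'$ is a pair of matroids $M,M'$ on the same finite set $E$ such that every circuit of $M$ is a union of circuits of $M'$. For a matroid $N$ on $E$ with rank function $r_N$, $r(N)=r_N(E)$, and $A\subseteq E$: $P_N(A)$ is the set of $e\in E\setminus A$ that are the smallest element of some cocircuit of $N$ contained in $E\setminus A$; $Q_N(A)$ is the set of $e\in A$ that are the smallest element of some circuit of $N$ contained in $A$; $\mathrm{Ext}_N(A)$ is the set of $e\in E\setminus A$ that are the smallest element of some circuit of $N$ contained in $A\cup\{e\}$, $\epsilon_N(A)=|\mathrm{Ext}_N(A)|$; $\mathrm{Int}_N(A)$ is the set of $e\in A$ that are the smallest element of some cocircuit of $N$ contained in $(E\setminus A)\cup\{e\}$, $\iota_N(A)=|\mathrm{Int}_N(A)|$; $cr_N(A)=r(N)-r_N(A)$ $(=|P_N(A)|)$ and $nl_N(A)=|A|-r_N(A)$ $(=|Q_N(A)|)$. -}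

module Defs where

open import Data.Nat using (ℕ; zero; suc; _∸_; _⊔_; _<_; _≡ᵇ_)
open import Data.Bool using (Bool; true; false; not; _∧_; _∨_; T)
open import Data.Fin using (Fin) renaming (_≤?_ to _≤ᶠ?_)
open import Data.Fin.Subset
  using (Subset; inside; outside; _∈_; _∉_; _⊆_; _∪_; _─_; ∁; ⁅_⁆; ∣_∣; ⋃)
  renaming (⊥ to ∅; ⊤ to Eᶠ)
open import Data.Fin.Subset.Properties using (_⊆?_; _⊂?_)
open import Data.Vec using (Vec; []; _∷_; lookup; tabulate)
open import Data.List using (List; []; _∷_; map; _++_; filterᵇ; foldr; allFin)
open import Data.Bool.ListAction using (all; any)
open import Data.List.Relation.Unary.All using (All)
open import Data.Product using (Σ; ∃; _×_)
open import Relation.Binary.PropositionalEquality using (_≡_)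
open import Relation.Nullary.Decidable using (⌊_⌋)

-- The ground set E is Fin n, linearly ordered by the usual order on Fin n.
-- Subsets of E are Data.Fin.Subset (characteristic vectors).

subsets : (n : ℕ) → List (Subset n)
subsets zero = [] ∷ []
subsets (suc n) = map (inside ∷_) (subsets n) ++ map (outside ∷_) (subsets n)

record Matroid (n : ℕ) : Set where
  field
    indep       : Subset n → Bool
    indep-∅     : indep ∅ ≡ true
    indep-hered : ∀ I J → J ⊆ I → T (indep I) → T (indep J)
    indep-aug   : ∀ I J → T (indep I) → T (indep J) → ∣ I ∣ < ∣ J ∣ →
                  ∃ λ e → e ∈ J × e ∉ I × T (indep (I ∪ ⁅ e ⁆))
open Matroid public

module _ {n : ℕ} where

  _⊆ᵇ_ : Subset n → Subset n → Bool
  X ⊆ᵇ Y = ⌊ X ⊆? Y ⌋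

  _⊂ᵇ_ : Subset n → Subset n → Bool
  X ⊂ᵇ Y = ⌊ X ⊂? Y ⌋

  isMin : Fin n → Subset n → Bool
  isMin e S = lookup S e ∧ all (λ f → not (lookup S f) ∨ ⌊ e ≤ᶠ? f ⌋) (allFin n)

  rankOf : (Subset n → Bool) → Subset n → ℕ
  rankOf ind A = foldr _⊔_ 0 (map ∣_∣ (filterᵇ (λ I → ind I ∧ (I ⊆ᵇ A)) (subsets n)))

  circuitOf : (Subset n → Bool) → Subset n → Bool
  circuitOf ind C = not (ind C) ∧ all (λ D → not (D ⊂ᵇ C) ∨ ind D) (subsets n)

  rk : Matroid n → Subset n → ℕ
  rk N = rankOf (indep N)

  r : Matroid n → ℕ
  r N = rk N Eᶠ

  -- independent sets of the dual matroid N*: I such that E \ I is spanning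
  coindep : Matroid n → Subset n → Bool
  coindep N I = rk N (∁ I) ≡ᵇ r N

  circuit : Matroid n → Subset n → Bool
  circuit N = circuitOf (indep N)

  cocircuit : Matroid n → Subset n → Bool
  cocircuit N = circuitOf (coindep N)

  P : Matroid n → Subset n → Subset n
  P N A = tabulate λ e → not (lookup A e) ∧
    any (λ D → cocircuit N D ∧ (D ⊆ᵇ ∁ A) ∧ isMin e D) (subsets n)

  Q : Matroid n → Subset n → Subset n
  Q N A = tabulate λ e → lookup A e ∧
    any (λ C → circuit N C ∧ (C ⊆ᵇ A) ∧ isMin e C) (subsets n)

  Ext : Matroid n → Subset n → Subset n
  Ext N A = tabulate λ e → not (lookup A e) ∧
    any (λ C → circuit N C ∧ (C ⊆ᵇ (A ∪ ⁅ e ⁆)) ∧ isMin e C) (subsets n)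

  Int : Matroid n → Subset n → Subset n
  Int N A = tabulate λ e → lookup A e ∧
    any (λ D → cocircuit N D ∧ (D ⊆ᵇ (∁ A ∪ ⁅ e ⁆)) ∧ isMin e D) (subsets n)

  ε : Matroid n → Subset n → ℕ
  ε N A = ∣ Ext N A ∣

  ι : Matroid n → Subset n → ℕ
  ι N A = ∣ Int N A ∣

  cr : Matroid n → Subset n → ℕ
  cr N A = r N ∸ rk N A

  nl : Matroid n → Subset n → ℕ
  nl N A = ∣ A ∣ ∸ rk N A

  Perspective : Matroid n → Matroid n → Set
  Perspective M M' = ∀ C → T (circuit M C) →
    Σ (List (Subset n)) λ Cs → All (λ C' → T (circuit M' C')) Cs × C ≡ ⋃ Cs

  φ* : Matroid n → Matroid n → Subset n → Subset n
  φ* M M' A = (A ∪ P M' A) ─ Int M' A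

  φ : Matroid n → Matroid n → Subset n → Subset n
  φ M M' A = (A ─ Q M A) ∪ Ext M A

module Submission where

-- Call x active for A (in a matroid N) when x is the least
-- element of a circuit of N inside A ∪ {x}.  Then Q_N(A) and Ext_N(A) are the
-- active elements inside and outside A, and φ(A) toggles the membership of
-- every active element.  The heart of the proof is that activity is
-- dependence on the elements of A above x; by a downward induction this shows
-- that toggling does not change which elements are active, so φ is an
-- involution exchanging Q and Ext, and that the inactive part of A is a basis
-- of A, so nl(A) = |Q(A)| and hence nl(φ A) = ε(A), ε(φ A) = nl(A).
-- For φ* we build the dual matroid N* (coindependent sets satisfy the matroid
-- axioms), prove its rank formula, hence cr_N(A) = nl_{N*}(E ─ A), and observe
-- that P_{N}(A), Int_{N}(A) are Q and Ext of E ─ A in N*; so φ* is φ for N*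
-- conjugated by complementation.

open import Defs
open import Data.Nat as ℕ using (ℕ; suc; _+_; _∸_; _⊔_; _≤_; _<_; z≤n)
import Data.Nat.Properties as ℕₚ
open import Data.Bool using (Bool; true; false; not; _∧_; _∨_; _xor_; T)
open import Data.Bool.Properties
  using (T-≡; T-∧; T-∨; T?; not-involutive; ∧-zeroʳ; ∧-identityʳ; xor-assoc; xor-same; xor-identityʳ)
open import Data.Bool.ListAction using (all; any)
open import Data.Fin as Fin using (Fin; toℕ)
import Data.Fin.Properties as Finₚ
open import Data.Fin.Induction using (<-wellFounded; >-wellFounded)
open import Data.Fin.Subset
  using (Subset; inside; outside; _∈_; _∉_; _⊆_; _⊂_; _∪_; _∩_; _─_; _-_; ∁; ⁅_⁆; ∣_∣)
  renaming (⊥ to ∅; ⊤ to Eᶠ)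
open import Data.Fin.Subset.Properties
  using (_∈?_; _⊂?_; ⊆-refl; ⊆-trans; ⊆-antisym; ⊆-min; ⊆⊤; ∉⊥; Empty-unique; nonempty?; anySubset?;
         p⊆p∪q; q⊆p∪q; x∈p∪q⁻; p∩q⊆p; p∩q⊆q; x∈p∩q⁺; x∈p∩q⁻; ∩-comm; p─q⊆p; x∈p∧x∉q⇒x∈p─q;
         x∈⁅x⁆; x∈⁅y⁆⇒x≡y; x∉∁p⇒x∈p; x∈∁p⇒x∉p; x∉p⇒x∈∁p; x∈p⇒x∉∁p; p⊆q⇒∁p⊇∁q;
         ∣⁅x⁆∣≡1; ∣⊥∣≡0; p⊆q⇒∣p∣≤∣q∣; p⊂q⇒∣p∣<∣q∣; p⊂q⇒p⊆q; x∈p⇒∣p-x∣<∣p∣)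
open import Data.Vec using ([]; _∷_; lookup; tabulate; here; there)
import Data.Vec.Properties as Vecₚ
open import Data.List using (List; []; _∷_; map; filterᵇ; foldr; allFin)
open import Data.List.Membership.Propositional using (lose) renaming (_∈_ to _∈ₗ_)
open import Data.List.Membership.Propositional.Properties using (∈-map⁺; ∈-++⁺ˡ; ∈-++⁺ʳ; ∈-allFin)
open import Data.List.Relation.Unary.Any as Any using (satisfied)
open import Data.List.Relation.Unary.Any.Properties using (any⁺; any⁻)
import Data.List.Relation.Unary.All as All
open import Data.List.Relation.Unary.All.Properties using (all⁺; all⁻)
open import Data.Product using (∃; _×_; _,_; proj₁; proj₂)
open import Data.Sum using (_⊎_; inj₁; inj₂; [_,_])
open import Data.Empty using (⊥-elim)
open import Relation.Binary.PropositionalEquality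
  using (_≡_; refl; sym; trans; cong; cong₂; subst; module ≡-Reasoning)
open import Relation.Nullary using (¬_; Dec; yes; no; ¬?)
open import Relation.Nullary.Decidable using (⌊_⌋; fromWitness; toWitness; _×-dec_; decidable-stable)
open import Function using (_∘_; id; Equivalence)
open import Induction.WellFounded using (Acc; acc)

private
  variable
    n : ℕ
    x y : Fin n
    p q : Subset n

x+c≡a+b⇒a∸x≡c∸b : ∀ {x c a b} → x + c ≡ a + b → b ≤ c → a ∸ x ≡ c ∸ b
x+c≡a+b⇒a∸x≡c∸b {x} {c} {a} {b} x+c≡a+b b≤c = begin
  a ∸ x             ≡⟨ cong (_∸ x) (ℕₚ.+-cancelʳ-≡ b a (x + (c ∸ b)) a+b≡) ⟩
  x + (c ∸ b) ∸ x   ≡⟨ ℕₚ.m+n∸m≡n x (c ∸ b) ⟩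
  c ∸ b             ∎
  where
  open ≡-Reasoning
  a+b≡ : a + b ≡ x + (c ∸ b) + b
  a+b≡ = begin
    a + b             ≡⟨ x+c≡a+b ⟨
    x + c             ≡⟨ cong (x +_) (ℕₚ.m∸n+n≡m b≤c) ⟨
    x + (c ∸ b + b)   ≡⟨ ℕₚ.+-assoc x (c ∸ b) b ⟨
    x + (c ∸ b) + b   ∎

T-not⁺ : ∀ {b} → ¬ T b → T (not b)
T-not⁺ {true}  ¬t = ¬t _
T-not⁺ {false} _  = _

T-not⁻ : ∀ {b} → T (not b) → ¬ T b
T-not⁻ {true} ()

T-ext : ∀ {a b} → (T a → T b) → (T b → T a) → a ≡ b
T-ext {true}  {true}  _ _ = refl
T-ext {true}  {false} f _ = ⊥-elim (f _)
T-ext {false} {true}  _ g = ⊥-elim (g _)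
T-ext {false} {false} _ _ = refl

T-xor-kept : ∀ {a b} → T (a ∧ not b) → T (a xor b)
T-xor-kept {true} {false} _ = _

T-xor-added : ∀ {a b} → ¬ T a → T (a xor b) → T b
T-xor-added {true}  ¬a _ = ⊥-elim (¬a _)
T-xor-added {false} _  t = t

∧-congˡ-T : ∀ {a b c} → (T a → b ≡ c) → a ∧ b ≡ a ∧ c
∧-congˡ-T {true}  b≡c = b≡c _
∧-congˡ-T {false} _   = refl

∈⇒T : x ∈ p → T (lookup p x)
∈⇒T x∈p = Equivalence.from T-≡ (Vecₚ.[]=⇒lookup x∈p)

T⇒∈ : T (lookup p x) → x ∈ p
T⇒∈ {p = p} {x} t = Vecₚ.lookup⇒[]= x p (Equivalence.to T-≡ t)

∈-tabulate⁺ : {f : Fin n → Bool} → T (f x) → x ∈ tabulate f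
∈-tabulate⁺ {x = x} {f} t = T⇒∈ (subst T (sym (Vecₚ.lookup∘tabulate f x)) t)

∈-tabulate⁻ : {f : Fin n → Bool} → x ∈ tabulate f → T (f x)
∈-tabulate⁻ {x = x} {f} x∈ = subst T (Vecₚ.lookup∘tabulate f x) (∈⇒T x∈)

lookup-ext : (∀ i → lookup p i ≡ lookup q i) → p ≡ q
lookup-ext {p = p} {q} same = begin
  p                     ≡⟨ Vecₚ.tabulate∘lookup p ⟨
  tabulate (lookup p)   ≡⟨ Vecₚ.tabulate-cong same ⟩
  tabulate (lookup q)   ≡⟨ Vecₚ.tabulate∘lookup q ⟩
  q                     ∎
  where open ≡-Reasoning

lookup-∪ : ∀ (p q : Subset n) i → lookup (p ∪ q) i ≡ lookup p i ∨ lookup q i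
lookup-∪ p q i = Vecₚ.lookup-zipWith _∨_ i p q

lookup-∩ : ∀ (p q : Subset n) i → lookup (p ∩ q) i ≡ lookup p i ∧ lookup q i
lookup-∩ p q i = Vecₚ.lookup-zipWith _∧_ i p q

lookup-─ : ∀ (p q : Subset n) i → lookup (p ─ q) i ≡ lookup p i ∧ not (lookup q i)
lookup-─ (a ∷ p) (true ∷ q)  Fin.zero    = sym (∧-zeroʳ a)
lookup-─ (a ∷ p) (false ∷ q) Fin.zero    = sym (∧-identityʳ a)
lookup-─ (a ∷ p) (b ∷ q)     (Fin.suc i) = lookup-─ p q i

lookup-∁ : ∀ (p : Subset n) i → lookup (∁ p) i ≡ not (lookup p i)
lookup-∁ p i = Vecₚ.lookup-map i not p

x∈p─q⇒x∉q : ∀ (p q : Subset n) → x ∈ p ─ q → x ∉ q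
x∈p─q⇒x∉q (_ ∷ p) (outside ∷ q) here       ()
x∈p─q⇒x∉q (_ ∷ p) (_ ∷ q)       (there x∈) (there x∈q) = x∈p─q⇒x∉q p q x∈ x∈q

∪-lub : ∀ {r : Subset n} → p ⊆ r → q ⊆ r → p ∪ q ⊆ r
∪-lub {p = p} {q} p⊆r q⊆r x∈ = [ p⊆r , q⊆r ] (x∈p∪q⁻ p q x∈)

∪-monoˡ : ∀ {r : Subset n} → p ⊆ q → p ∪ r ⊆ q ∪ r
∪-monoˡ {p = p} {q} {r} p⊆q = ∪-lub (⊆-trans p⊆q (p⊆p∪q r)) (q⊆p∪q q r)

⁅x⁆⊆ : x ∈ p → ⁅ x ⁆ ⊆ p
⁅x⁆⊆ {x = x} {p} x∈p y∈⁅x⁆ = subst (_∈ p) (sym (x∈⁅y⁆⇒x≡y x y∈⁅x⁆)) x∈p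

⊆∪⁅x⁆⇒⊆ : q ⊆ p ∪ ⁅ x ⁆ → x ∉ q → q ⊆ p
⊆∪⁅x⁆⇒⊆ {q = q} {p} {x} q⊆ x∉q {y} y∈q =
  [ id , (λ y∈⁅x⁆ → ⊥-elim (x∉q (subst (_∈ q) (x∈⁅y⁆⇒x≡y x y∈⁅x⁆) y∈q))) ] (x∈p∪q⁻ p ⁅ x ⁆ (q⊆ y∈q))

∪-absorb : x ∈ p → p ∪ ⁅ x ⁆ ≡ p
∪-absorb {x = x} {p} x∈p = ⊆-antisym (∪-lub ⊆-refl (⁅x⁆⊆ x∈p)) (p⊆p∪q ⁅ x ⁆)

p⊆p─q∪q : ∀ (p q : Subset n) → p ⊆ (p ─ q) ∪ q
p⊆p─q∪q p q {x} x∈p with x ∈? q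
... | yes x∈q = q⊆p∪q (p ─ q) q x∈q
... | no  x∉q = p⊆p∪q q (x∈p∧x∉q⇒x∈p─q x∈p x∉q)

∁-involutive : ∀ (p : Subset n) → ∁ (∁ p) ≡ p
∁-involutive p = ⊆-antisym (x∉∁p⇒x∈p ∘ x∈∁p⇒x∉p) (x∉p⇒x∈∁p ∘ x∈p⇒x∉∁p)

∣p∪q∣+∣p∩q∣ : ∀ (p q : Subset n) → ∣ p ∪ q ∣ + ∣ p ∩ q ∣ ≡ ∣ p ∣ + ∣ q ∣
∣p∪q∣+∣p∩q∣ []          []          = refl
∣p∪q∣+∣p∩q∣ (true ∷ p)  (true ∷ q)  = cong suc (begin
  ∣ p ∪ q ∣ + suc ∣ p ∩ q ∣   ≡⟨ ℕₚ.+-suc ∣ p ∪ q ∣ ∣ p ∩ q ∣ ⟩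
  suc (∣ p ∪ q ∣ + ∣ p ∩ q ∣) ≡⟨ cong suc (∣p∪q∣+∣p∩q∣ p q) ⟩
  suc (∣ p ∣ + ∣ q ∣)         ≡⟨ ℕₚ.+-suc ∣ p ∣ ∣ q ∣ ⟨
  ∣ p ∣ + suc ∣ q ∣           ∎)
  where open ≡-Reasoning
∣p∪q∣+∣p∩q∣ (true ∷ p)  (false ∷ q) = cong suc (∣p∪q∣+∣p∩q∣ p q)
∣p∪q∣+∣p∩q∣ (false ∷ p) (true ∷ q)  =
  trans (cong suc (∣p∪q∣+∣p∩q∣ p q)) (sym (ℕₚ.+-suc ∣ p ∣ ∣ q ∣))
∣p∪q∣+∣p∩q∣ (false ∷ p) (false ∷ q) = ∣p∪q∣+∣p∩q∣ p q

∣p∣≡∣p∩q∣+∣p─q∣ : ∀ (p q : Subset n) → ∣ p ∣ ≡ ∣ p ∩ q ∣ + ∣ p ─ q ∣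
∣p∣≡∣p∩q∣+∣p─q∣ []          []          = refl
∣p∣≡∣p∩q∣+∣p─q∣ (true ∷ p)  (true ∷ q)  = cong suc (∣p∣≡∣p∩q∣+∣p─q∣ p q)
∣p∣≡∣p∩q∣+∣p─q∣ (true ∷ p)  (false ∷ q) =
  trans (cong suc (∣p∣≡∣p∩q∣+∣p─q∣ p q)) (sym (ℕₚ.+-suc ∣ p ∩ q ∣ ∣ p ─ q ∣))
∣p∣≡∣p∩q∣+∣p─q∣ (false ∷ p) (true ∷ q)  = ∣p∣≡∣p∩q∣+∣p─q∣ p q
∣p∣≡∣p∩q∣+∣p─q∣ (false ∷ p) (false ∷ q) = ∣p∣≡∣p∩q∣+∣p─q∣ p q

∣p∪q∣≤∣p∣+∣q∣ : ∀ (p q : Subset n) → ∣ p ∪ q ∣ ≤ ∣ p ∣ + ∣ q ∣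
∣p∪q∣≤∣p∣+∣q∣ p q = subst (∣ p ∪ q ∣ ≤_) (∣p∪q∣+∣p∩q∣ p q) (ℕₚ.m≤m+n _ _)

disjoint⇒∣p∪q∣ : (∀ {x} → x ∈ p → x ∉ q) → ∣ p ∪ q ∣ ≡ ∣ p ∣ + ∣ q ∣
disjoint⇒∣p∪q∣ {n} {p} {q} disjoint = begin
  ∣ p ∪ q ∣                 ≡⟨ ℕₚ.+-identityʳ _ ⟨
  ∣ p ∪ q ∣ + 0             ≡⟨ cong (∣ p ∪ q ∣ +_) (∣⊥∣≡0 n) ⟨
  ∣ p ∪ q ∣ + ∣ ∅ {n} ∣     ≡⟨ cong (λ s → ∣ p ∪ q ∣ + ∣ s ∣) p∩q≡∅ ⟨
  ∣ p ∪ q ∣ + ∣ p ∩ q ∣     ≡⟨ ∣p∪q∣+∣p∩q∣ p q ⟩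
  ∣ p ∣ + ∣ q ∣             ∎
  where
  open ≡-Reasoning
  p∩q≡∅ : p ∩ q ≡ ∅
  p∩q≡∅ = Empty-unique (λ (x , x∈) → let x∈p , x∈q = x∈p∩q⁻ p q x∈ in disjoint x∈p x∈q)

∣p∪⁅x⁆∣≡1+∣p∣ : x ∉ p → ∣ p ∪ ⁅ x ⁆ ∣ ≡ suc ∣ p ∣
∣p∪⁅x⁆∣≡1+∣p∣ {x = x} {p} x∉p = begin
  ∣ p ∪ ⁅ x ⁆ ∣     ≡⟨ disjoint⇒∣p∪q∣ (λ y∈p y∈⁅x⁆ → x∉p (subst (_∈ p) (x∈⁅y⁆⇒x≡y x y∈⁅x⁆) y∈p)) ⟩
  ∣ p ∣ + ∣ ⁅ x ⁆ ∣ ≡⟨ cong (∣ p ∣ +_) (∣⁅x⁆∣≡1 x) ⟩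
  ∣ p ∣ + 1         ≡⟨ ℕₚ.+-comm ∣ p ∣ 1 ⟩
  suc ∣ p ∣         ∎
  where open ≡-Reasoning

∈-subsets : ∀ {n} (p : Subset n) → p ∈ₗ subsets n
∈-subsets []          = Any.here refl
∈-subsets {suc m} (true ∷ p)  = ∈-++⁺ˡ (∈-map⁺ (inside ∷_) (∈-subsets p))
∈-subsets {suc m} (false ∷ p) =
  ∈-++⁺ʳ (map (inside ∷_) (subsets m)) (∈-map⁺ (outside ∷_) (∈-subsets p))

any-subsets⁺ : (f : Subset n → Bool) (S : Subset n) → T (f S) → T (any f (subsets n))
any-subsets⁺ f S t = any⁺ f (lose (∈-subsets S) t)

any-subsets⁻ : ∀ {n} (f : Subset n → Bool) → T (any f (subsets n)) → ∃ λ S → T (f S)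
any-subsets⁻ {n} f t = satisfied (any⁻ f (subsets n) t)

all-subsets⁺ : ∀ {n} (f : Subset n → Bool) → (∀ S → T (f S)) → T (all f (subsets n))
all-subsets⁺ {n} f t = all⁻ f {subsets n} (All.tabulate (λ {S} _ → t S))

all-subsets⁻ : ∀ {n} (f : Subset n → Bool) → T (all f (subsets n)) → ∀ S → T (f S)
all-subsets⁻ {n} f t S = All.lookup (all⁺ f (subsets n) t) (∈-subsets S)

isMin⁺ : ∀ {e : Fin n} {S} → e ∈ S → (∀ {f} → f ∈ S → e Fin.≤ f) → T (isMin e S)
isMin⁺ {n} {e} {S} e∈S least =
  Equivalence.from (T-∧ {lookup S e}) (∈⇒T e∈S , all⁻ _ {allFin n} (All.tabulate (λ {f} _ → below f)))
  where
  below : ∀ f → T (not (lookup S f) ∨ ⌊ e Fin.≤? f ⌋)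
  below f with T? (lookup S f)
  ... | yes f∈S = Equivalence.from (T-∨ {not (lookup S f)}) (inj₂ (fromWitness (least (T⇒∈ f∈S))))
  ... | no  f∉S = Equivalence.from (T-∨ {not (lookup S f)}) (inj₁ (T-not⁺ f∉S))

isMin⁻ : ∀ {e : Fin n} {S} → T (isMin e S) → e ∈ S × (∀ {f} → f ∈ S → e Fin.≤ f)
isMin⁻ {n} {e} {S} t =
  let e∈S , rest = Equivalence.to (T-∧ {lookup S e}) t
  in T⇒∈ e∈S , λ {f} f∈S → below f∈S (All.lookup (all⁺ _ (allFin n) rest) (∈-allFin f))
  where
  below : ∀ {f} → f ∈ S → T (not (lookup S f) ∨ ⌊ e Fin.≤? f ⌋) → e Fin.≤ f
  below f∈S t with Equivalence.to T-∨ t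
  ... | inj₁ f∉S = ⊥-elim (T-not⁻ f∉S (∈⇒T f∈S))
  ... | inj₂ e≤f = toWitness e≤f

least-element : ∀ {S : Subset n} → x ∈ S → ∃ λ m → m ∈ S × (∀ {f} → f ∈ S → m Fin.≤ f)
least-element {x = x} {S} x∈S = descend x (<-wellFounded x) x∈S
  where
  descend : ∀ x → Acc Fin._<_ x → x ∈ S → ∃ λ m → m ∈ S × (∀ {f} → f ∈ S → m Fin.≤ f)
  descend x (acc smaller) x∈S with Finₚ.any? (λ f → f ∈? S ×-dec f Fin.<? x)
  ... | yes (f , f∈S , f<x) = descend f (smaller f<x) f∈S
  ... | no  none            = x , x∈S , λ f∈S → ℕₚ.≮⇒≥ (λ f<x → none (_ , f∈S , f<x))

-- The part of A strictly above x; activity is governed by these "tails".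
above : Fin n → Subset n → Subset n
above x A = tabulate (λ y → lookup A y ∧ ⌊ x Fin.<? y ⌋)

above⁺ : y ∈ p → x Fin.< y → y ∈ above x p
above⁺ {y = y} {p = p} y∈p x<y =
  ∈-tabulate⁺ (Equivalence.from (T-∧ {lookup p y}) (∈⇒T y∈p , fromWitness x<y))

above⁻ : y ∈ above x p → y ∈ p × x Fin.< y
above⁻ {y = y} {p = p} y∈ =
  let y∈p , x<y = Equivalence.to (T-∧ {lookup p y}) (∈-tabulate⁻ y∈) in T⇒∈ y∈p , toWitness x<y

above⊆ : above x p ⊆ p
above⊆ {p = p} = proj₁ ∘ above⁻ {p = p}

x∉above : x ∉ above x p
x∉above {p = p} x∈ = ℕₚ.<-irrefl refl (proj₂ (above⁻ {p = p} x∈))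

above-anti : ∀ {z} → x Fin.< z → above z p ⊆ above x p
above-anti {p = p} x<z y∈ = let y∈p , z<y = above⁻ {p = p} y∈ in above⁺ y∈p (ℕₚ.<-trans x<z z<y)

⊆ᵇ⁺ : p ⊆ q → T (p ⊆ᵇ q)
⊆ᵇ⁺ = fromWitness

⊆ᵇ⁻ : T (p ⊆ᵇ q) → p ⊆ q
⊆ᵇ⁻ = toWitness

size≤max : (f : Subset n → Bool) (xs : List (Subset n)) {S : Subset n} →
           S ∈ₗ xs → T (f S) → ∣ S ∣ ≤ foldr _⊔_ 0 (map ∣_∣ (filterᵇ f xs))
size≤max f (S' ∷ xs) S∈ fS with f S' in eq
size≤max f (S' ∷ xs) (Any.here refl) fS | true  = ℕₚ.m≤m⊔n _ _
size≤max f (S' ∷ xs) (Any.there S∈) fS  | true  = ℕₚ.m≤n⇒m≤o⊔n _ (size≤max f xs S∈ fS)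
size≤max f (S' ∷ xs) (Any.here refl) fS | false = ⊥-elim (subst T eq fS)
size≤max f (S' ∷ xs) (Any.there S∈) fS  | false = size≤max f xs S∈ fS

max≤ : (f : Subset n → Bool) (xs : List (Subset n)) {m : ℕ} →
       (∀ S → T (f S) → ∣ S ∣ ≤ m) → foldr _⊔_ 0 (map ∣_∣ (filterᵇ f xs)) ≤ m
max≤ f []        bound = z≤n
max≤ f (S ∷ xs)  bound with f S in eq
... | true  = ℕₚ.⊔-lub (bound S (subst T (sym eq) _)) (max≤ f xs bound)
... | false = max≤ f xs bound

module MatroidTheory {n : ℕ} (N : Matroid n) where

  -- Independence as a proposition; a record, so that the set is recoverable
  -- from a proof by unification.
  record Independent (I : Subset n) : Set where
    constructor independent
    field isIndependent : T (indep N I)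
  open Independent public

  independent? : ∀ I → Dec (Independent I)
  independent? I with T? (indep N I)
  ... | yes i = yes (independent i)
  ... | no ¬i = no (¬i ∘ isIndependent)

  ∅-independent : Independent ∅
  ∅-independent = independent (Equivalence.from T-≡ (indep-∅ N))

  hereditary : ∀ {I J} → J ⊆ I → Independent I → Independent J
  hereditary {I} {J} J⊆I (independent i) = independent (indep-hered N I J J⊆I i)

  augment : ∀ {I J} → Independent I → Independent J → ∣ I ∣ < ∣ J ∣ →
            ∃ λ e → e ∈ J × e ∉ I × Independent (I ∪ ⁅ e ⁆)
  augment {I} {J} (independent i) (independent j) ∣I∣<∣J∣ =
    let e , e∈J , e∉I , i+e = indep-aug N I J i j ∣I∣<∣J∣ in e , e∈J , e∉I , independent i+e

  record IsBasis (B U : Subset n) : Set where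
    field
      basis⊆       : B ⊆ U
      basis-indep  : Independent B
      basis-maxl   : ∀ {y} → y ∈ U → y ∉ B → ¬ Independent (B ∪ ⁅ y ⁆)
  open IsBasis public

  private
    Saturated : Subset n → Subset n → List (Fin n) → Set
    Saturated J U ys = ∀ {y} → y ∈ₗ ys → y ∈ U → y ∉ J → ¬ Independent (J ∪ ⁅ y ⁆)

    grow : ∀ {U} (ys : List (Fin n)) {I} → Independent I → I ⊆ U →
           ∃ λ J → I ⊆ J × J ⊆ U × Independent J × Saturated J U ys
    grow []       {I} i I⊆U = I , id , I⊆U , i , λ ()
    grow {U} (y ∷ ys) {I} i I⊆U with y ∈? U ×-dec independent? (I ∪ ⁅ y ⁆)
    ... | yes (y∈U , i+y) =
      let J , I+y⊆J , J⊆U , j , sat = grow ys i+y (∪-lub I⊆U (⁅x⁆⊆ y∈U))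
          added : y ∈ J
          added = I+y⊆J (q⊆p∪q I ⁅ y ⁆ (x∈⁅x⁆ y))
      in J , ⊆-trans (p⊆p∪q ⁅ y ⁆) I+y⊆J , J⊆U , j ,
         λ { (Any.here refl) _ y∉J _ → y∉J added ; (Any.there y∈ys) → sat y∈ys }
    ... | no rejected =
      let J , I⊆J , J⊆U , j , sat = grow ys i I⊆U
      in J , I⊆J , J⊆U , j ,
         λ { (Any.here refl) y∈U _ j+y → rejected (y∈U , hereditary (∪-monoˡ I⊆J) j+y)
           ; (Any.there y∈ys) → sat y∈ys }

  extend : ∀ {I U} → Independent I → I ⊆ U → ∃ λ B → I ⊆ B × IsBasis B U
  extend i I⊆U =
    let B , I⊆B , B⊆U , b , sat = grow (allFin n) i I⊆U
    in B , I⊆B , record { basis⊆ = B⊆U ; basis-indep = b ; basis-maxl = sat (∈-allFin _) }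

  basis-exists : ∀ U → ∃ λ B → IsBasis B U
  basis-exists U = let B , _ , B-basis = extend ∅-independent (⊆-min U) in B , B-basis

  basis≤basis : ∀ {B B' U} → IsBasis B U → IsBasis B' U → ∣ B ∣ ≤ ∣ B' ∣
  basis≤basis {B} {B'} b b' with ∣ B ∣ ℕₚ.≤? ∣ B' ∣
  ... | yes ≤ = ≤
  ... | no  ≰ =
    let e , e∈B , e∉B' , i = augment (basis-indep b') (basis-indep b) (ℕₚ.≰⇒> ≰)
    in ⊥-elim (basis-maxl b' (basis⊆ b e∈B) e∉B' i)

  independent≤basis : ∀ {I B U} → Independent I → I ⊆ U → IsBasis B U → ∣ I ∣ ≤ ∣ B ∣
  independent≤basis i I⊆U b =
    let B' , I⊆B' , b' = extend i I⊆U in ℕₚ.≤-trans (p⊆q⇒∣p∣≤∣q∣ I⊆B') (basis≤basis b' b)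

  independent≤rk : ∀ {I U} → Independent I → I ⊆ U → ∣ I ∣ ≤ rk N U
  independent≤rk {I} (independent i) I⊆U =
    size≤max _ (subsets n) (∈-subsets I) (Equivalence.from (T-∧ {indep N I}) (i , ⊆ᵇ⁺ I⊆U))

  rk-basis : ∀ {B U} → IsBasis B U → rk N U ≡ ∣ B ∣
  rk-basis b = ℕₚ.≤-antisym
    (max≤ _ (subsets n) λ I t → let i , I⊆U = Equivalence.to (T-∧ {indep N I}) t
                                in independent≤basis (independent i) (⊆ᵇ⁻ I⊆U) b)
    (independent≤rk (basis-indep b) (basis⊆ b))

  rk-mono : ∀ {U V} → U ⊆ V → rk N U ≤ rk N V
  rk-mono {U} U⊆V = let B , b = basis-exists U in
    subst (_≤ _) (sym (rk-basis b)) (independent≤rk (basis-indep b) (⊆-trans (basis⊆ b) U⊆V))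

  -- x depends on U: some independent subset of U becomes dependent when x is
  -- added (for x ∉ U this says that x lies in the closure of U).
  DependsOn : Subset n → Fin n → Set
  DependsOn U x = ∃ λ I → Independent I × I ⊆ U × ¬ Independent (I ∪ ⁅ x ⁆)

  depends-mono : ∀ {U V x} → U ⊆ V → DependsOn U x → DependsOn V x
  depends-mono U⊆V (I , i , I⊆U , dep) = I , i , ⊆-trans I⊆U U⊆V , dep

  -- Any basis of U witnesses the dependence of an outside element on U:
  -- otherwise B ∪ {x} would beat a basis of U ∪ {x} that avoids x.
  depends⇒basis : ∀ {U x B} → DependsOn U x → x ∉ U → IsBasis B U → ¬ Independent (B ∪ ⁅ x ⁆)
  depends⇒basis {U} {x} {B} (I , i , I⊆U , dep) x∉U b b+x
    with extend i (⊆-trans I⊆U (p⊆p∪q ⁅ x ⁆))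
  ... | L , I⊆L , l = ℕₚ.<-irrefl refl (begin-strict
    ∣ B ∣          <⟨ ℕₚ.n<1+n ∣ B ∣ ⟩
    suc ∣ B ∣      ≡⟨ ∣p∪⁅x⁆∣≡1+∣p∣ (x∉U ∘ basis⊆ b) ⟨
    ∣ B ∪ ⁅ x ⁆ ∣  ≤⟨ independent≤basis b+x (∪-monoˡ (basis⊆ b)) l ⟩
    ∣ L ∣          ≤⟨ independent≤basis (basis-indep l) (⊆∪⁅x⁆⇒⊆ (basis⊆ l) x∉L) b ⟩
    ∣ B ∣          ∎)
    where
    open ℕₚ.≤-Reasoning
    x∉L : x ∉ L
    x∉L x∈L = dep (hereditary (∪-lub I⊆L (⁅x⁆⊆ x∈L)) (basis-indep l))

  basis-∪ : ∀ {B U V} → (∀ {y} → y ∈ V → y ∉ U → DependsOn U y) → IsBasis B U → IsBasis B (U ∪ V)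
  basis-∪ {B} {U} {V} V→U b = record
    { basis⊆      = ⊆-trans (basis⊆ b) (p⊆p∪q V)
    ; basis-indep = basis-indep b
    ; basis-maxl  = λ y∈ → maximal (x∈p∪q⁻ U V y∈)
    }
    where
    maximal : ∀ {y} → y ∈ U ⊎ y ∈ V → y ∉ B → ¬ Independent (B ∪ ⁅ y ⁆)
    maximal (inj₁ y∈U) y∉B = basis-maxl b y∈U y∉B
    maximal {y} (inj₂ y∈V) y∉B with y ∈? U
    ... | yes y∈U = basis-maxl b y∈U y∉B
    ... | no  y∉U = depends⇒basis (V→U y∈V y∉U) y∉U b

  depends-trans : ∀ {U V x} → (∀ {y} → y ∈ V → y ∉ U → DependsOn U y) →
                  DependsOn V x → x ∉ U → DependsOn U x
  depends-trans {U} {V} {x} V→U x→V x∉U with x ∈? V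
  ... | yes x∈V = V→U x∈V x∉U
  ... | no  x∉V =
    let B , b = basis-exists U
    in B , basis-indep b , basis⊆ b ,
       depends⇒basis (depends-mono (q⊆p∪q U V) x→V) ([ x∉U , x∉V ] ∘ x∈p∪q⁻ U V) (basis-∪ V→U b)

  circuit⇒dependent : ∀ {C} → T (circuit N C) → ¬ Independent C
  circuit⇒dependent {C} c (independent i) = T-not⁻ (proj₁ (Equivalence.to (T-∧ {not (indep N C)}) c)) i

  circuit⇒minimal : ∀ {C D} → T (circuit N C) → D ⊂ C → Independent D
  circuit⇒minimal {C} {D} c D⊂C with Equivalence.to (T-∨ {not (D ⊂ᵇ C)})
      (all-subsets⁻ _ (proj₂ (Equivalence.to (T-∧ {not (indep N C)}) c)) D)
  ... | inj₁ not⊂ = ⊥-elim (T-not⁻ not⊂ (fromWitness D⊂C))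
  ... | inj₂ i    = independent i

  minimal⇒circuit : ∀ {C} → ¬ Independent C → (∀ {D} → D ⊂ C → Independent D) → T (circuit N C)
  minimal⇒circuit {C} dep minimal =
    Equivalence.from (T-∧ {not (indep N C)}) (T-not⁺ (dep ∘ independent) , all-subsets⁺ _ proper)
    where
    proper : ∀ D → T (not (D ⊂ᵇ C) ∨ indep N D)
    proper D with D ⊂? C
    ... | yes D⊂C = isIndependent (minimal D⊂C)
    ... | no  D⊄C = _

  circuit-nonempty : ∀ {C} → T (circuit N C) → ∃ λ x → x ∈ C
  circuit-nonempty {C} c with nonempty? C
  ... | yes x∈C = x∈C
  ... | no  empty =
    ⊥-elim (circuit⇒dependent c (subst Independent (sym (Empty-unique empty)) ∅-independent))

  dependent⇒circuit : ∀ {D} → ¬ Independent D → ∃ λ C → T (circuit N C) × C ⊆ D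
  dependent⇒circuit {D} = shrink (suc ∣ D ∣) ℕₚ.≤-refl
    where
    shrink : ∀ k {D} → ∣ D ∣ < k → ¬ Independent D → ∃ λ C → T (circuit N C) × C ⊆ D
    shrink (suc k) {D} ∣D∣<1+k dep with anySubset? (λ D' → D' ⊂? D ×-dec ¬? (independent? D'))
    ... | yes (D' , D'⊂D , dep') =
      let C , c , C⊆D' = shrink k (ℕₚ.<-≤-trans (p⊂q⇒∣p∣<∣q∣ D'⊂D) (ℕ.s≤s⁻¹ ∣D∣<1+k)) dep'
      in C , c , ⊆-trans C⊆D' (p⊂q⇒p⊆q D'⊂D)
    ... | no none =
      D , minimal⇒circuit dep (λ D'⊂D → decidable-stable (independent? _) (λ dep' → none (_ , D'⊂D , dep')))
        , ⊆-refl

  basis-trace : ∀ {B' W B y} → IsBasis B' W → B' ⊆ B → Independent B → y ∈ B → y ∈ W → y ∈ B'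
  basis-trace {B'} {y = y} b' B'⊆B i y∈B y∈W =
    decidable-stable (y ∈? B') λ y∉B' → basis-maxl b' y∈W y∉B' (hereditary (∪-lub B'⊆B (⁅x⁆⊆ y∈B)) i)

module Activity {n : ℕ} (N : Matroid n) where
  open MatroidTheory N

  leastInCircuitWithin : Subset n → Fin n → Bool
  leastInCircuitWithin S x = any (λ C → circuit N C ∧ (C ⊆ᵇ S) ∧ isMin x C) (subsets n)

  -- x is active for A when it is the least element of a circuit inside A ∪ {x}.
  -- (Q, Ext, P and Int of the paper all describe active elements.)
  active : Subset n → Fin n → Bool
  active A x = leastInCircuitWithin (A ∪ ⁅ x ⁆) x

  active-inside : ∀ {A x} → x ∈ A → active A x ≡ leastInCircuitWithin A x
  active-inside {x = x} x∈A = cong (λ S → leastInCircuitWithin S x) (∪-absorb x∈A)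

  ActiveCircuit : Subset n → Fin n → Subset n → Set
  ActiveCircuit A x C =
    T (circuit N C) × C ⊆ A ∪ ⁅ x ⁆ × x ∈ C × (∀ {f} → f ∈ C → x Fin.≤ f)

  active⁺ : ∀ {A x} C → ActiveCircuit A x C → T (active A x)
  active⁺ {A} {x} C (c , C⊆A+x , x∈C , least) = any-subsets⁺ _ C
    (Equivalence.from (T-∧ {circuit N C}) (c , Equivalence.from (T-∧ {C ⊆ᵇ (A ∪ ⁅ x ⁆)})
      (⊆ᵇ⁺ C⊆A+x , isMin⁺ x∈C least)))

  active⁻ : ∀ {A x} → T (active A x) → ∃ (ActiveCircuit A x)
  active⁻ {A} {x} t =
    let C , t′ = any-subsets⁻ _ t
        c , t″ = Equivalence.to (T-∧ {circuit N C}) t′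
        C⊆A+x , t‴ = Equivalence.to (T-∧ {C ⊆ᵇ (A ∪ ⁅ x ⁆)}) t″
        x∈C , least = isMin⁻ t‴
    in C , c , ⊆ᵇ⁻ C⊆A+x , x∈C , least

  -- Activity is dependence on the part of A above x: removing x from a witnessing
  -- circuit leaves an independent set above x, and conversely a circuit inside
  -- I ∪ {x} with I independent above x must contain x as its least element.
  active⇒depends : ∀ {A x} → T (active A x) → DependsOn (above x A) x
  active⇒depends {A} {x} t with active⁻ t
  ... | C , c , C⊆A+x , x∈C , least = C ─ ⁅ x ⁆ , rest-indep , rest⊆above , dep
    where
    x∉rest : x ∉ C ─ ⁅ x ⁆
    x∉rest x∈ = x∈p─q⇒x∉q C ⁅ x ⁆ x∈ (x∈⁅x⁆ x)
    rest-indep : Independent (C ─ ⁅ x ⁆)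
    rest-indep = circuit⇒minimal c (p─q⊆p C ⁅ x ⁆ , x , x∈C , x∉rest)
    rest⊆above : C ─ ⁅ x ⁆ ⊆ above x A
    rest⊆above {y} y∈ with x∈p∪q⁻ A ⁅ x ⁆ (C⊆A+x (p─q⊆p C ⁅ x ⁆ y∈))
    ... | inj₁ y∈A = above⁺ y∈A (Finₚ.≤∧≢⇒< (least (p─q⊆p C ⁅ x ⁆ y∈)) (λ { refl → x∉rest y∈ }))
    ... | inj₂ y∈⁅x⁆ = ⊥-elim (x∈p─q⇒x∉q C ⁅ x ⁆ y∈ y∈⁅x⁆)
    dep : ¬ Independent ((C ─ ⁅ x ⁆) ∪ ⁅ x ⁆)
    dep = circuit⇒dependent c ∘ hereditary (p⊆p─q∪q C ⁅ x ⁆)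

  depends⇒active : ∀ {A x} → DependsOn (above x A) x → T (active A x)
  depends⇒active {A} {x} (I , i , I⊆above , dep) with dependent⇒circuit dep
  ... | C , c , C⊆I+x = active⁺ C (c , ∪-monoˡ (⊆-trans I⊆above above⊆) ∘ C⊆I+x , x∈C , least)
    where
    x∈C : x ∈ C
    x∈C with x ∈? C
    ... | yes x∈C = x∈C
    ... | no  x∉C = ⊥-elim (circuit⇒dependent c (hereditary (⊆∪⁅x⁆⇒⊆ C⊆I+x x∉C) i))
    least : ∀ {f} → f ∈ C → x Fin.≤ f
    least {f} f∈C with x∈p∪q⁻ I ⁅ x ⁆ (C⊆I+x f∈C)
    ... | inj₁ f∈I   = ℕₚ.<⇒≤ (proj₂ (above⁻ {p = A} (I⊆above f∈I)))
    ... | inj₂ f∈⁅x⁆ = ℕₚ.≤-reflexive (cong toℕ (sym (x∈⁅y⁆⇒x≡y x f∈⁅x⁆)))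

  transfer : ∀ {S F x} → (∀ {w} → x Fin.< w → w ∈ S → w ∉ F → DependsOn (above w F) w) →
             DependsOn (above x S) x → DependsOn (above x F) x
  transfer {S} {F} {x} repair x→S = depends-trans step x→S (x∉above {p = F})
    where
    step : ∀ {w} → w ∈ above x S → w ∉ above x F → DependsOn (above x F) w
    step w∈ w∉ = let w∈S , x<w = above⁻ {p = S} w∈ in
      depends-mono (above-anti {p = F} x<w) (repair x<w w∈S (λ w∈F → w∉ (above⁺ w∈F x<w)))

  passive : Subset n → Subset n
  passive A = tabulate (λ x → lookup A x ∧ not (active A x))

  passive⊆ : ∀ {A} → passive A ⊆ A
  passive⊆ {A} {x} x∈ = T⇒∈ (proj₁ (Equivalence.to (T-∧ {lookup A x}) (∈-tabulate⁻ x∈)))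

  passive⇒inactive : ∀ {A x} → x ∈ passive A → ¬ T (active A x)
  passive⇒inactive {A} {x} x∈ = T-not⁻ (proj₂ (Equivalence.to (T-∧ {lookup A x}) (∈-tabulate⁻ x∈)))

  non-passive⇒active : ∀ {A x} → x ∈ A → x ∉ passive A → T (active A x)
  non-passive⇒active {A} {x} x∈A x∉ with T? (active A x)
  ... | yes t = t
  ... | no ¬t = ⊥-elim (x∉ (∈-tabulate⁺ (Equivalence.from (T-∧ {lookup A x}) (∈⇒T x∈A , T-not⁺ ¬t))))

  missing⇒depends : ∀ {A F} → passive A ⊆ F → ∀ {z} → z ∈ A → z ∉ F → DependsOn (above z F) z
  missing⇒depends {A} {F} passive⊆F {z} = go z (>-wellFounded z)
    where
    go : ∀ z → Acc Fin._>_ z → z ∈ A → z ∉ F → DependsOn (above z F) z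
    go z (acc later) z∈A z∉F =
      transfer (λ z<w w∈A w∉F → go _ (later z<w) w∈A w∉F)
               (active⇒depends (non-passive⇒active z∈A (z∉F ∘ passive⊆F)))

  -- No circuit lies inside the passive part of A: its least element would be active.
  passive-circuit-free : ∀ {A C} → T (circuit N C) → ¬ C ⊆ passive A
  passive-circuit-free {A} {C} c C⊆P =
    let x , x∈C         = circuit-nonempty c
        m , m∈C , least = least-element x∈C
    in passive⇒inactive (C⊆P m∈C)
         (active⁺ C (c , ⊆-trans (⊆-trans C⊆P passive⊆) (p⊆p∪q ⁅ m ⁆) , m∈C , least))

  -- The passive part of A is a basis of A (the greedy basis from the top).
  passive-basis : ∀ A → IsBasis (passive A) A
  passive-basis A = record
    { basis⊆      = passive⊆
    ; basis-indep = decidable-stable (independent? _) λ dep →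
                      let C , c , C⊆P = dependent⇒circuit dep in passive-circuit-free c C⊆P
    ; basis-maxl  = maximal
    }
    where
    maximal : ∀ {y} → y ∈ A → y ∉ passive A → ¬ Independent (passive A ∪ ⁅ y ⁆)
    maximal {y} y∈A y∉P i =
      let I , _ , I⊆above , dep = transfer (λ _ → missing⇒depends ⊆-refl)
                                    (active⇒depends (non-passive⇒active y∈A y∉P))
      in dep (hereditary (∪-monoˡ (⊆-trans I⊆above above⊆)) i)

  -- Toggle the activity status: the active elements of A leave, the active
  -- elements outside A join.  (This is φ of the paper.)
  toggle : Subset n → Subset n
  toggle A = tabulate (λ x → lookup A x xor active A x)

  passive⊆toggle : ∀ {A} → passive A ⊆ toggle A
  passive⊆toggle {A} {x} x∈ = ∈-tabulate⁺ (T-xor-kept {lookup A x} (∈-tabulate⁻ x∈))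

  toggle-added⇒active : ∀ {A x} → x ∈ toggle A → x ∉ A → T (active A x)
  toggle-added⇒active {A} {x} x∈ x∉A = T-xor-added (x∉A ∘ T⇒∈) (∈-tabulate⁻ x∈)

  -- Toggling does not change which elements are active: the two sets agree on
  -- their passive parts, and every element in one but not the other depends on
  -- the part of the other above it.
  active-toggle : ∀ A x → active (toggle A) x ≡ active A x
  active-toggle A x = T-ext forward backward
    where
    forward : T (active (toggle A) x) → T (active A x)
    forward t = depends⇒active (transfer {S = toggle A} {F = A}
      (λ _ w∈ w∉A → active⇒depends (toggle-added⇒active w∈ w∉A)) (active⇒depends t))
    backward : T (active A x) → T (active (toggle A) x)
    backward t = depends⇒active (transfer {S = A} {F = toggle A}
      (λ _ → missing⇒depends passive⊆toggle) (active⇒depends t))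

  toggle-involutive : ∀ A → toggle (toggle A) ≡ A
  toggle-involutive A = lookup-ext λ i → begin
    lookup (toggle (toggle A)) i                  ≡⟨ Vecₚ.lookup∘tabulate _ i ⟩
    lookup (toggle A) i xor active (toggle A) i   ≡⟨ cong₂ _xor_ (Vecₚ.lookup∘tabulate _ i) (active-toggle A i) ⟩
    (lookup A i xor active A i) xor active A i    ≡⟨ xor-assoc (lookup A i) (active A i) (active A i) ⟩
    lookup A i xor (active A i xor active A i)    ≡⟨ cong (lookup A i xor_) (xor-same (active A i)) ⟩
    lookup A i xor false                          ≡⟨ xor-identityʳ _ ⟩
    lookup A i                                    ∎
    where open ≡-Reasoning

  activePart : Subset n → Subset n
  activePart A = tabulate (λ x → lookup A x ∧ active A x)

  size-split : ∀ A → ∣ A ∣ ≡ ∣ activePart A ∣ + ∣ passive A ∣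
  size-split A = trans (∣p∣≡∣p∩q∣+∣p─q∣ A activeSet) (cong₂ (λ X Y → ∣ X ∣ + ∣ Y ∣) ∩≡ ─≡)
    where
    activeSet : Subset n
    activeSet = tabulate (active A)
    ∩≡ : A ∩ activeSet ≡ activePart A
    ∩≡ = lookup-ext λ i → trans (lookup-∩ A activeSet i)
           (trans (cong (lookup A i ∧_) (Vecₚ.lookup∘tabulate _ i))
                  (sym (Vecₚ.lookup∘tabulate _ i)))
    ─≡ : A ─ activeSet ≡ passive A
    ─≡ = lookup-ext λ i → trans (lookup-─ A activeSet i)
           (trans (cong (λ b → lookup A i ∧ not b) (Vecₚ.lookup∘tabulate _ i))
                  (sym (Vecₚ.lookup∘tabulate _ i)))

  nl≡∣activePart∣ : ∀ A → nl N A ≡ ∣ activePart A ∣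
  nl≡∣activePart∣ A = begin
    ∣ A ∣ ∸ rk N A
      ≡⟨ cong₂ _∸_ (size-split A) (rk-basis (passive-basis A)) ⟩
    (∣ activePart A ∣ + ∣ passive A ∣) ∸ ∣ passive A ∣
      ≡⟨ ℕₚ.m+n∸n≡m ∣ activePart A ∣ ∣ passive A ∣ ⟩
    ∣ activePart A ∣ ∎
    where open ≡-Reasoning

  Q≡activePart : ∀ A → Q N A ≡ activePart A
  Q≡activePart A = lookup-ext λ i → begin
    lookup (Q N A) i                          ≡⟨ Vecₚ.lookup∘tabulate _ i ⟩
    lookup A i ∧ leastInCircuitWithin A i     ≡⟨ ∧-congˡ-T (sym ∘ active-inside ∘ T⇒∈) ⟩
    lookup A i ∧ active A i                   ≡⟨ Vecₚ.lookup∘tabulate _ i ⟨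
    lookup (activePart A) i                   ∎
    where open ≡-Reasoning

  φ≡toggle : ∀ M' A → φ N M' A ≡ toggle A
  φ≡toggle M' A = lookup-ext λ i → begin
    lookup ((A ─ Q N A) ∪ Ext N A) i
      ≡⟨ lookup-∪ (A ─ Q N A) (Ext N A) i ⟩
    lookup (A ─ Q N A) i ∨ lookup (Ext N A) i
      ≡⟨ cong₂ _∨_ (lookup-─ A (Q N A) i) (Vecₚ.lookup∘tabulate _ i) ⟩
    (lookup A i ∧ not (lookup (Q N A) i)) ∨ (not (lookup A i) ∧ active A i)
      ≡⟨ cong (λ q → (lookup A i ∧ not q) ∨ (not (lookup A i) ∧ active A i))
              (trans (cong (λ S → lookup S i) (Q≡activePart A)) (Vecₚ.lookup∘tabulate _ i)) ⟩
    (lookup A i ∧ not (lookup A i ∧ active A i)) ∨ (not (lookup A i) ∧ active A i)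
      ≡⟨ entry (lookup A i) (active A i) ⟩
    lookup A i xor active A i
      ≡⟨ Vecₚ.lookup∘tabulate _ i ⟨
    lookup (toggle A) i ∎
    where
    open ≡-Reasoning
    entry : ∀ a d → (a ∧ not (a ∧ d)) ∨ (not a ∧ d) ≡ a xor d
    entry true  true  = refl
    entry true  false = refl
    entry false d     = refl

  activePart-toggle : ∀ A → activePart (toggle A) ≡ Ext N A
  activePart-toggle A = lookup-ext λ i → begin
    lookup (activePart (toggle A)) i                  ≡⟨ Vecₚ.lookup∘tabulate _ i ⟩
    lookup (toggle A) i ∧ active (toggle A) i         ≡⟨ cong₂ _∧_ (Vecₚ.lookup∘tabulate _ i) (active-toggle A i) ⟩
    (lookup A i xor active A i) ∧ active A i          ≡⟨ entry (lookup A i) (active A i) ⟩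
    not (lookup A i) ∧ active A i                     ≡⟨ Vecₚ.lookup∘tabulate _ i ⟨
    lookup (Ext N A) i                                ∎
    where
    open ≡-Reasoning
    entry : ∀ a d → (a xor d) ∧ d ≡ not a ∧ d
    entry true  true  = refl
    entry true  false = refl
    entry false true  = refl
    entry false false = refl

  Ext-toggle : ∀ A → Ext N (toggle A) ≡ activePart A
  Ext-toggle A = lookup-ext λ i → begin
    lookup (Ext N (toggle A)) i                       ≡⟨ Vecₚ.lookup∘tabulate _ i ⟩
    not (lookup (toggle A) i) ∧ active (toggle A) i
      ≡⟨ cong₂ (λ t d → not t ∧ d) (Vecₚ.lookup∘tabulate _ i) (active-toggle A i) ⟩
    not (lookup A i xor active A i) ∧ active A i      ≡⟨ entry (lookup A i) (active A i) ⟩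
    lookup A i ∧ active A i                           ≡⟨ Vecₚ.lookup∘tabulate _ i ⟨
    lookup (activePart A) i                           ∎
    where
    open ≡-Reasoning
    entry : ∀ a d → not (a xor d) ∧ d ≡ a ∧ d
    entry true  true  = refl
    entry true  false = refl
    entry false true  = refl
    entry false false = refl

module Duality {n : ℕ} (N : Matroid n) where
  open MatroidTheory N

  rk≤r : ∀ U → rk N U ≤ r N
  rk≤r U = rk-mono ⊆⊤

  coindep⁺ : ∀ {I} → r N ≤ rk N (∁ I) → T (coindep N I)
  coindep⁺ {I} r≤rk = ℕₚ.≡⇒≡ᵇ _ _ (ℕₚ.≤-antisym (rk≤r (∁ I)) r≤rk)

  coindep⁻ : ∀ {I} → T (coindep N I) → rk N (∁ I) ≡ r N
  coindep⁻ {I} = ℕₚ.≡ᵇ⇒≡ (rk N (∁ I)) (r N)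

  coindep-witness : ∀ {I B} → Independent B → B ⊆ ∁ I → r N ≤ ∣ B ∣ → T (coindep N I)
  coindep-witness i B⊆∁I r≤∣B∣ = coindep⁺ (ℕₚ.≤-trans r≤∣B∣ (independent≤rk i B⊆∁I))

  coindep-basis-size : ∀ {I B} → T (coindep N I) → IsBasis B (∁ I) → ∣ B ∣ ≡ r N
  coindep-basis-size t b = trans (sym (rk-basis b)) (coindep⁻ t)

  coindep-∅ : coindep N ∅ ≡ true
  coindep-∅ = Equivalence.to T-≡ (coindep⁺ (rk-mono (λ _ → x∉p⇒x∈∁p ∉⊥)))

  coindep-hered : ∀ I J → J ⊆ I → T (coindep N I) → T (coindep N J)
  coindep-hered I J J⊆I t = coindep⁺ (subst (_≤ rk N (∁ J)) (coindep⁻ t) (rk-mono (p⊆q⇒∁p⊇∁q J⊆I)))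

  -- Exchange for coindependent I and J, in terms of a basis B' of ∁I ∩ ∁J
  -- extended to bases BI of ∁I and BJ of ∁J (both of full size r).
  module Exchange {I J B' BI BJ : Subset n} (tI : T (coindep N I)) (tJ : T (coindep N J))
                  (b' : IsBasis B' (∁ I ∩ ∁ J))
                  (B'⊆BI : B' ⊆ BI) (bI : IsBasis BI (∁ I))
                  (B'⊆BJ : B' ⊆ BJ) (bJ : IsBasis BJ (∁ J)) where

    addable : ∀ {e} → e ∉ BI → T (coindep N (I ∪ ⁅ e ⁆))
    addable {e} e∉BI =
      coindep-witness (basis-indep bI) BI⊆ (ℕₚ.≤-reflexive (sym (coindep-basis-size tI bI)))
      where
      BI⊆ : BI ⊆ ∁ (I ∪ ⁅ e ⁆)
      BI⊆ {z} z∈BI = x∉p⇒x∈∁p ([ x∈∁p⇒x∉p (basis⊆ bI z∈BI)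
                                , (λ z∈⁅e⁆ → e∉BI (subst (_∈ BI) (x∈⁅y⁆⇒x≡y e z∈⁅e⁆) z∈BI)) ]
                               ∘ x∈p∪q⁻ I ⁅ e ⁆)

    -- Otherwise J ─ I ⊆ BI, and counting inside BI and BJ gives ∣ J ∣ ≤ ∣ I ∣.
    upper : J ─ I ⊆ BI → ∣ B' ∣ + ∣ J ─ I ∣ ≤ r N
    upper J─I⊆BI = begin
      ∣ B' ∣ + ∣ J ─ I ∣    ≡⟨ disjoint⇒∣p∪q∣ (λ z∈B' z∈J─I → x∈∁p⇒x∉p (p∩q⊆q (∁ I) (∁ J) (basis⊆ b' z∈B'))
                                                                 (p─q⊆p J I z∈J─I)) ⟨
      ∣ B' ∪ (J ─ I) ∣      ≤⟨ p⊆q⇒∣p∣≤∣q∣ (∪-lub B'⊆BI J─I⊆BI) ⟩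
      ∣ BI ∣                ≡⟨ coindep-basis-size tI bI ⟩
      r N                   ∎
      where open ℕₚ.≤-Reasoning

    lower : r N ≤ ∣ B' ∣ + ∣ I ─ J ∣
    lower = begin
      r N                   ≡⟨ coindep-basis-size tJ bJ ⟨
      ∣ BJ ∣                ≤⟨ p⊆q⇒∣p∣≤∣q∣ BJ⊆ ⟩
      ∣ B' ∪ (I ─ J) ∣      ≤⟨ ∣p∪q∣≤∣p∣+∣q∣ B' (I ─ J) ⟩
      ∣ B' ∣ + ∣ I ─ J ∣    ∎
      where
      open ℕₚ.≤-Reasoning
      BJ⊆ : BJ ⊆ B' ∪ (I ─ J)
      BJ⊆ {z} z∈BJ with z ∈? I
      ... | yes z∈I = q⊆p∪q B' (I ─ J) (x∈p∧x∉q⇒x∈p─q z∈I (x∈∁p⇒x∉p (basis⊆ bJ z∈BJ)))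
      ... | no  z∉I = p⊆p∪q (I ─ J) (basis-trace b' B'⊆BJ (basis-indep bJ) z∈BJ
                                       (x∈p∩q⁺ (x∉p⇒x∈∁p z∉I , basis⊆ bJ z∈BJ)))

    counting : J ─ I ⊆ BI → ∣ J ∣ ≤ ∣ I ∣
    counting J─I⊆BI = begin
      ∣ J ∣                   ≡⟨ ∣p∣≡∣p∩q∣+∣p─q∣ J I ⟩
      ∣ J ∩ I ∣ + ∣ J ─ I ∣   ≤⟨ ℕₚ.+-mono-≤ (ℕₚ.≤-reflexive (cong ∣_∣ (∩-comm J I)))
                                 (ℕₚ.+-cancelˡ-≤ ∣ B' ∣ _ _ (ℕₚ.≤-trans (upper J─I⊆BI) lower)) ⟩
      ∣ I ∩ J ∣ + ∣ I ─ J ∣   ≡⟨ ∣p∣≡∣p∩q∣+∣p─q∣ I J ⟨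
      ∣ I ∣                   ∎
      where open ℕₚ.≤-Reasoning

    augmentation : ∣ I ∣ < ∣ J ∣ → ∃ λ e → e ∈ J × e ∉ I × T (coindep N (I ∪ ⁅ e ⁆))
    augmentation ∣I∣<∣J∣ with Finₚ.any? (λ e → e ∈? J ×-dec ¬? (e ∈? I) ×-dec ¬? (e ∈? BI))
    ... | yes (e , e∈J , e∉I , e∉BI) = e , e∈J , e∉I , addable e∉BI
    ... | no none = ⊥-elim (ℕₚ.<⇒≱ ∣I∣<∣J∣ (counting J─I⊆BI))
      where
      J─I⊆BI : J ─ I ⊆ BI
      J─I⊆BI {e} e∈ = decidable-stable (e ∈? BI) λ e∉BI →
        none (e , p─q⊆p J I e∈ , x∈p─q⇒x∉q J I e∈ , e∉BI)

  coindep-aug : ∀ I J → T (coindep N I) → T (coindep N J) → ∣ I ∣ < ∣ J ∣ →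
                ∃ λ e → e ∈ J × e ∉ I × T (coindep N (I ∪ ⁅ e ⁆))
  coindep-aug I J tI tJ =
    let B' , b'          = basis-exists (∁ I ∩ ∁ J)
        BI , B'⊆BI , bI  = extend (basis-indep b') (⊆-trans (basis⊆ b') (p∩q⊆p (∁ I) (∁ J)))
        BJ , B'⊆BJ , bJ  = extend (basis-indep b') (⊆-trans (basis⊆ b') (p∩q⊆q (∁ I) (∁ J)))
    in Exchange.augmentation tI tJ b' B'⊆BI bI B'⊆BJ bJ

  -- The dual matroid N*, whose independent sets are the coindependent sets of N
  -- and whose circuits are therefore the cocircuits of N.
  dual : Matroid n
  dual = record
    { indep       = coindep N
    ; indep-∅     = coindep-∅
    ; indep-hered = coindep-hered
    ; indep-aug   = coindep-aug
    }

  module Dual = MatroidTheory dual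

  -- Rank of the dual at S, in terms of a basis B' of ∁S extended to a basis B
  -- of N: then K = S ─ B is a basis of S in N*.
  module DualRank {S B' B : Subset n} (b' : IsBasis B' (∁ S)) (B'⊆B : B' ⊆ B) (b : IsBasis B Eᶠ) where
    K : Subset n
    K = S ─ B

    ∣B∣≡r : ∣ B ∣ ≡ r N
    ∣B∣≡r = sym (rk-basis b)

    K-coindep : T (coindep N K)
    K-coindep = coindep-witness (basis-indep b) (λ z∈B → x∉p⇒x∈∁p (λ z∈K → x∈p─q⇒x∉q S B z∈K z∈B))
                                (ℕₚ.≤-reflexive (sym ∣B∣≡r))

    -- Adding y ∈ S ∩ B to K drops the rank of the complement: B - y is a basis of it.
    drop-basis : ∀ {y} → y ∈ S → y ∈ B → IsBasis (B - y) (∁ (K ∪ ⁅ y ⁆))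
    drop-basis {y} y∈S y∈B = record
      { basis⊆ = λ {z} z∈ → x∉p⇒x∈∁p ([ (λ z∈K → x∈p─q⇒x∉q S B z∈K (p─q⊆p B ⁅ y ⁆ z∈))
                                        , x∈p─q⇒x∉q B ⁅ y ⁆ z∈ ] ∘ x∈p∪q⁻ K ⁅ y ⁆)
      ; basis-indep = hereditary (p─q⊆p B ⁅ y ⁆) (basis-indep b)
      ; basis-maxl = maximal
      }
      where
      maximal : ∀ {z} → z ∈ ∁ (K ∪ ⁅ y ⁆) → z ∉ B - y → ¬ Independent ((B - y) ∪ ⁅ z ⁆)
      maximal {z} z∈ z∉B-y i = basis-maxl b' z∈∁S (z∉B ∘ B'⊆B) (hereditary (∪-monoˡ B'⊆B-y) i)
        where
        z∉K+y : z ∉ K ∪ ⁅ y ⁆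
        z∉K+y = x∈∁p⇒x∉p z∈
        z∉B : z ∉ B
        z∉B z∈B = z∉B-y (x∈p∧x∉q⇒x∈p─q z∈B (z∉K+y ∘ q⊆p∪q K ⁅ y ⁆))
        z∈∁S : z ∈ ∁ S
        z∈∁S = x∉p⇒x∈∁p (λ z∈S → z∉K+y (p⊆p∪q ⁅ y ⁆ (x∈p∧x∉q⇒x∈p─q z∈S z∉B)))
        B'⊆B-y : B' ⊆ B - y
        B'⊆B-y {w} w∈B' = x∈p∧x∉q⇒x∈p─q (B'⊆B w∈B')
          (λ w∈⁅y⁆ → x∈∁p⇒x∉p (basis⊆ b' w∈B') (subst (_∈ S) (sym (x∈⁅y⁆⇒x≡y y w∈⁅y⁆)) y∈S))

    K-basis : Dual.IsBasis K S
    K-basis = record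
      { basis⊆ = p─q⊆p S B
      ; basis-indep = Dual.independent K-coindep
      ; basis-maxl = λ {y} y∈S y∉K (Dual.independent t) →
          let y∈B = decidable-stable (y ∈? B) (y∉K ∘ x∈p∧x∉q⇒x∈p─q y∈S) in
          ℕₚ.<-irrefl refl (begin-strict
            r N                         ≡⟨ coindep⁻ t ⟨
            rk N (∁ (K ∪ ⁅ y ⁆))        ≡⟨ rk-basis (drop-basis y∈S y∈B) ⟩
            ∣ B - y ∣                   <⟨ x∈p⇒∣p-x∣<∣p∣ y∈B ⟩
            ∣ B ∣                       ≡⟨ ∣B∣≡r ⟩
            r N                         ∎)
      }
      where open ℕₚ.≤-Reasoning

    B─S≡B' : B ─ S ≡ B'
    B─S≡B' = ⊆-antisym
      (λ z∈ → basis-trace b' B'⊆B (basis-indep b) (p─q⊆p B S z∈) (x∉p⇒x∈∁p (x∈p─q⇒x∉q B S z∈)))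
      (λ z∈B' → x∈p∧x∉q⇒x∈p─q (B'⊆B z∈B') (x∈∁p⇒x∉p (basis⊆ b' z∈B')))

    count : ∣ K ∣ + ∣ B ∣ ≡ ∣ S ∣ + ∣ B' ∣
    count = begin
      ∣ S ─ B ∣ + ∣ B ∣                   ≡⟨ cong (∣ S ─ B ∣ +_) (∣p∣≡∣p∩q∣+∣p─q∣ B S) ⟩
      ∣ S ─ B ∣ + (∣ B ∩ S ∣ + ∣ B ─ S ∣) ≡⟨ cong₂ (λ X Y → ∣ S ─ B ∣ + (∣ X ∣ + ∣ Y ∣)) (∩-comm B S) B─S≡B' ⟩
      ∣ S ─ B ∣ + (∣ S ∩ B ∣ + ∣ B' ∣)    ≡⟨ ℕₚ.+-assoc ∣ S ─ B ∣ _ _ ⟨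
      ∣ S ─ B ∣ + ∣ S ∩ B ∣ + ∣ B' ∣      ≡⟨ cong (_+ ∣ B' ∣) (ℕₚ.+-comm ∣ S ─ B ∣ _) ⟩
      ∣ S ∩ B ∣ + ∣ S ─ B ∣ + ∣ B' ∣      ≡⟨ cong (_+ ∣ B' ∣) (∣p∣≡∣p∩q∣+∣p─q∣ S B) ⟨
      ∣ S ∣ + ∣ B' ∣                      ∎
      where open ≡-Reasoning

    rank-identity : rk dual S + r N ≡ ∣ S ∣ + rk N (∁ S)
    rank-identity = begin
      rk dual S + r N     ≡⟨ cong₂ _+_ (Dual.rk-basis K-basis) (sym ∣B∣≡r) ⟩
      ∣ K ∣ + ∣ B ∣       ≡⟨ count ⟩
      ∣ S ∣ + ∣ B' ∣      ≡⟨ cong (∣ S ∣ +_) (rk-basis b') ⟨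
      ∣ S ∣ + rk N (∁ S)  ∎
      where open ≡-Reasoning

  dual-rank : ∀ S → rk dual S + r N ≡ ∣ S ∣ + rk N (∁ S)
  dual-rank S =
    let B' , b'       = basis-exists (∁ S)
        B , B'⊆B , b  = extend (basis-indep b') (⊆⊤ {p = B'})
    in DualRank.rank-identity b' B'⊆B b

  cr≡nl-dual : ∀ A → cr N A ≡ nl dual (∁ A)
  cr≡nl-dual A = sym (x+c≡a+b⇒a∸x≡c∸b identity (rk≤r A))
    where
    identity : rk dual (∁ A) + r N ≡ ∣ ∁ A ∣ + rk N A
    identity = trans (dual-rank (∁ A)) (cong (λ X → ∣ ∁ A ∣ + rk N X) (∁-involutive A))

module Nullity {n : ℕ} (M M' : Matroid n) where
  open Activity M

  φ-involutive : ∀ A → φ M M' (φ M M' A) ≡ A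
  φ-involutive A = begin
    φ M M' (φ M M' A)   ≡⟨ φ≡toggle M' (φ M M' A) ⟩
    toggle (φ M M' A)   ≡⟨ cong toggle (φ≡toggle M' A) ⟩
    toggle (toggle A)   ≡⟨ toggle-involutive A ⟩
    A                   ∎
    where open ≡-Reasoning

  nl-φ : ∀ A → nl M (φ M M' A) ≡ ε M A
  nl-φ A = begin
    nl M (φ M M' A)              ≡⟨ cong (nl M) (φ≡toggle M' A) ⟩
    nl M (toggle A)              ≡⟨ nl≡∣activePart∣ (toggle A) ⟩
    ∣ activePart (toggle A) ∣    ≡⟨ cong ∣_∣ (activePart-toggle A) ⟩
    ∣ Ext M A ∣                  ∎
    where open ≡-Reasoning

  ε-φ : ∀ A → ε M (φ M M' A) ≡ nl M A
  ε-φ A = begin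
    ∣ Ext M (φ M M' A) ∣         ≡⟨ cong (∣_∣ ∘ Ext M) (φ≡toggle M' A) ⟩
    ∣ Ext M (toggle A) ∣         ≡⟨ cong ∣_∣ (Ext-toggle A) ⟩
    ∣ activePart A ∣             ≡⟨ nl≡∣activePart∣ A ⟨
    nl M A                       ∎
    where open ≡-Reasoning

-- The paper's φ*: by duality it is φ for the dual of M', conjugated by complement.
module Corank {n : ℕ} (M M' : Matroid n) where
  open Duality M'
  open Activity dual

  Int≡Ext-dual : ∀ A → Int M' A ≡ Ext dual (∁ A)
  Int≡Ext-dual A = lookup-ext λ i → begin
    lookup (Int M' A) i                          ≡⟨ Vecₚ.lookup∘tabulate _ i ⟩
    lookup A i ∧ active (∁ A) i                  ≡⟨ cong (_∧ active (∁ A) i) (not-involutive (lookup A i)) ⟨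
    not (not (lookup A i)) ∧ active (∁ A) i      ≡⟨ cong (λ b → not b ∧ active (∁ A) i) (lookup-∁ A i) ⟨
    not (lookup (∁ A) i) ∧ active (∁ A) i        ≡⟨ Vecₚ.lookup∘tabulate _ i ⟨
    lookup (Ext dual (∁ A)) i                    ∎
    where open ≡-Reasoning

  φ*≡∁toggle∁ : ∀ A → φ* M M' A ≡ ∁ (toggle (∁ A))
  φ*≡∁toggle∁ A = lookup-ext λ i → begin
    lookup ((A ∪ P M' A) ─ Int M' A) i
      ≡⟨ lookup-─ (A ∪ P M' A) (Int M' A) i ⟩
    lookup (A ∪ P M' A) i ∧ not (lookup (Int M' A) i)
      ≡⟨ cong₂ (λ u v → u ∧ not v) (trans (lookup-∪ A (P M' A) i) (cong (lookup A i ∨_) (P-entry i)))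
                                    (Vecₚ.lookup∘tabulate _ i) ⟩
    (lookup A i ∨ (not (lookup A i) ∧ active (∁ A) i)) ∧ not (lookup A i ∧ active (∁ A) i)
      ≡⟨ entry (lookup A i) (active (∁ A) i) ⟩
    not (not (lookup A i) xor active (∁ A) i)
      ≡⟨ cong (λ b → not (b xor active (∁ A) i)) (lookup-∁ A i) ⟨
    not (lookup (∁ A) i xor active (∁ A) i)
      ≡⟨ cong not (Vecₚ.lookup∘tabulate _ i) ⟨
    not (lookup (toggle (∁ A)) i)
      ≡⟨ lookup-∁ (toggle (∁ A)) i ⟨
    lookup (∁ (toggle (∁ A))) i ∎
    where
    open ≡-Reasoning
    P-entry : ∀ i → lookup (P M' A) i ≡ not (lookup A i) ∧ active (∁ A) i
    P-entry i = trans (Vecₚ.lookup∘tabulate _ i)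
      (∧-congˡ-T (λ a∉ → sym (active-inside (T⇒∈ (subst T (sym (lookup-∁ A i)) a∉)))))
    entry : ∀ a d → (a ∨ (not a ∧ d)) ∧ not (a ∧ d) ≡ not (not a xor d)
    entry true  true  = refl
    entry true  false = refl
    entry false true  = refl
    entry false false = refl

  ∁φ* : ∀ A → ∁ (φ* M M' A) ≡ toggle (∁ A)
  ∁φ* A = trans (cong ∁ (φ*≡∁toggle∁ A)) (∁-involutive (toggle (∁ A)))

  φ*-involutive : ∀ A → φ* M M' (φ* M M' A) ≡ A
  φ*-involutive A = begin
    φ* M M' (φ* M M' A)           ≡⟨ φ*≡∁toggle∁ (φ* M M' A) ⟩
    ∁ (toggle (∁ (φ* M M' A)))    ≡⟨ cong (∁ ∘ toggle) (∁φ* A) ⟩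
    ∁ (toggle (toggle (∁ A)))     ≡⟨ cong ∁ (toggle-involutive (∁ A)) ⟩
    ∁ (∁ A)                       ≡⟨ ∁-involutive A ⟩
    A                             ∎
    where open ≡-Reasoning

  cr-φ* : ∀ A → cr M' (φ* M M' A) ≡ ι M' A
  cr-φ* A = begin
    cr M' (φ* M M' A)              ≡⟨ cr≡nl-dual (φ* M M' A) ⟩
    nl dual (∁ (φ* M M' A))        ≡⟨ cong (nl dual) (∁φ* A) ⟩
    nl dual (toggle (∁ A))         ≡⟨ nl≡∣activePart∣ (toggle (∁ A)) ⟩
    ∣ activePart (toggle (∁ A)) ∣  ≡⟨ cong ∣_∣ (activePart-toggle (∁ A)) ⟩
    ∣ Ext dual (∁ A) ∣             ≡⟨ cong ∣_∣ (Int≡Ext-dual A) ⟨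
    ι M' A                         ∎
    where open ≡-Reasoning

  ι-φ* : ∀ A → ι M' (φ* M M' A) ≡ cr M' A
  ι-φ* A = begin
    ∣ Int M' (φ* M M' A) ∣          ≡⟨ cong ∣_∣ (Int≡Ext-dual (φ* M M' A)) ⟩
    ∣ Ext dual (∁ (φ* M M' A)) ∣    ≡⟨ cong (∣_∣ ∘ Ext dual) (∁φ* A) ⟩
    ∣ Ext dual (toggle (∁ A)) ∣     ≡⟨ cong ∣_∣ (Ext-toggle (∁ A)) ⟩
    ∣ activePart (∁ A) ∣            ≡⟨ nl≡∣activePart∣ (∁ A) ⟨
    nl dual (∁ A)                   ≡⟨ cr≡nl-dual A ⟨
    cr M' A                         ∎
    where open ≡-Reasoning

theorem5 : (n : ℕ) (M M' : Matroid n) → Perspective M M' →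
    (∀ A → φ* M M' (φ* M M' A) ≡ A) × (∀ A → φ M M' (φ M M' A) ≡ A) ×
    (∀ (A : Subset n) → cr M' (φ* M M' A) ≡ ι M' A × ι M' (φ* M M' A) ≡ cr M' A) ×
    (∀ (A : Subset n) → nl M (φ M M' A) ≡ ε M A × ε M (φ M M' A) ≡ nl M A)
theorem5 n M M' _ =
    φ*-involutive , φ-involutive
  , (λ A → cr-φ* A , ι-φ* A)
  , (λ A → nl-φ A , ε-φ A)
  where
  open Nullity M M'
  open Corank M M'
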